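{- For all integers $k,m\geq 4$ and every positive integer $n$, $R(B_{k,m},S_n)>\left\lfloor\frac{k+m}{2}\right\rfloor+n$.
   Context: For graphs $G_1,G_2$, $R(G_1,G_2)$ is the least integer $N$ such that every red/blue edge-coloring of $K_N$ contains a red copy of $G_1$ or a blue copy of $G_2$. $S_n$ denotes the star with $n$ edges ($n+1$ vertices). $B_{k,m}$ denotes the bistar on $k+m$ vertices: a vertex $v$ of degree $k$, a vertex $w$ adjacent to $v$ of degree $m$, and $k+m-2$ further vertices of degree $1$. -}

module Defs where

open import Data.Nat using (ℕ; suc; _+_; _≤_; _/_)
open import Data.Fin using (Fin; toℕ)
open import Data.Product using (Σ; _×_)
open import Data.Sum using (_⊎_)
open import Relation.Binary.PropositionalEquality using (_≡_)
open import Relation.Nullary using (¬_)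
open import Function.Definitions using (Injective)

data Colour : Set where
  red blue : Colour

record Graph : Set₁ where
  field
    order : ℕ
    Adj   : Fin order → Fin order → Set
open Graph public

-- A red/blue edge-colouring of the complete graph K_N on vertex set Fin N.
-- (Values on the diagonal are irrelevant.)
record Colouring (N : ℕ) : Set where
  field
    col : Fin N → Fin N → Colour
    sym : ∀ i j → col i j ≡ col j i
open Colouring public

ContainsCopy : {N : ℕ} → Colouring N → Colour → Graph → Set
ContainsCopy {N} χ c G =
  Σ (Fin (order G) → Fin N) λ f →
    Injective _≡_ _≡_ f × (∀ i j → Adj G i j → col χ (f i) (f j) ≡ c)

Arrows : ℕ → Graph → Graph → Set
Arrows N G₁ G₂ = (χ : Colouring N) → ContainsCopy χ red G₁ ⊎ ContainsCopy χ blue G₂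

-- R(G₁,G₂) > N, with R the least N such that Arrows holds:
-- no N' ≤ N satisfies Arrows.
RamseyGreaterThan : Graph → Graph → ℕ → Set
RamseyGreaterThan G₁ G₂ N = ∀ N' → N' ≤ N → ¬ Arrows N' G₁ G₂

-- Star S_n: vertices Fin (n+1), centre 0 adjacent to every other vertex.
data StarAdj' : ℕ → ℕ → Set where
  out : ∀ j → StarAdj' 0 (suc j)
  inn : ∀ j → StarAdj' (suc j) 0

Star : ℕ → Graph
Star n = record { order = suc n ; Adj = λ i j → StarAdj' (toℕ i) (toℕ j) }

-- Bistar B_{k,m} on vertices 0 .. k+m-1: vertex 0 (= v, degree k) and
-- vertex 1 (= w, degree m) are adjacent; vertices 2..k are the k-1 leaves
-- of v; vertices k+1 .. k+m-1 are the m-1 leaves of w.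
data BiEdge (k : ℕ) : ℕ → ℕ → Set where
  centre : BiEdge k 0 1
  leafV  : ∀ j → 2 ≤ j → j ≤ k → BiEdge k 0 j
  leafW  : ∀ j → suc k ≤ j → BiEdge k 1 j

BiAdj : ℕ → ℕ → ℕ → Set
BiAdj k i j = BiEdge k i j ⊎ BiEdge k j i

Bistar : ℕ → ℕ → Graph
Bistar k m = record { order = k + m ; Adj = λ i j → BiAdj k (toℕ i) (toℕ j) }

-- For every N ≤ ⌊p/2⌋ + n, where p = k + m, we exhibit a red/blue colouring of K_N
-- with no red B_{k,m} and no blue S_n.  All colourings are handled by one criterion
-- ('refuting-colouring'): if the diagonal is red, then for every red edge uv fewer
-- than p vertices are red-adjacent to u or v, and every blue neighbourhood has fewer
-- than n vertices, then neither a red B_{k,m} (whose k+m vertices all lie red-near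
-- its central edge) nor a blue S_n exists.  Sizes are measured by injections into
-- Fin t ('AtMost t P'), which turn the bounds into the pigeonhole principle.
--
-- Three colourings cover all N:
--   * N < p: everything red.
--   * N ≥ p ≠ 10: the circulant colouring of Z_N, red iff the cyclic distance is at
--     most r, where 3r + 2 ≤ p and ⌊p/2⌋ ≤ 2r ('Radius').  The red neighbourhoods of
--     an edge cover an arc of 3r+1 vertices; a blue neighbourhood has N - 2r - 1.
--   * p = 10: no radius exists, so we blow up the circulant of radius 1 on Z_⌊N/2⌋,
--     replacing each vertex by a pair (plus one leftover vertex when N is odd).
module Submission where

open import Defs hiding (sym)
open import Data.Nat
open import Data.Nat.Properties
open import Data.Nat.DivMod
open import Algebra.Properties.CommutativeSemigroup +-commutativeSemigroup using (xy∙z≈xz∙y; xy∙z≈yz∙x)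
open import Data.Nat.Tactic.RingSolver using (solve)
open import Data.List using (_∷_; [])
open import Data.Fin using (Fin; zero; suc; toℕ; fromℕ<; _↑ˡ_; _↑ʳ_; splitAt; join; quotient; remainder; combine)
open import Data.Fin.Properties
  using (toℕ<n; toℕ-injective; toℕ-fromℕ<; pigeonhole; ↑ˡ-injective; ↑ʳ-injective;
         splitAt-↑ˡ; splitAt-↑ʳ; join-splitAt; combine-injective; combine-remQuot)
  renaming (suc-injective to Fin-suc-injective)
open import Data.Product using (Σ; ∃-syntax; _×_; _,_)
open import Data.Sum using (_⊎_; inj₁; inj₂; [_,_]′; swap) renaming (map to ⊎-map)
open import Data.Empty using (⊥-elim)
open import Function using (id; _∘_)
open import Level using (0ℓ)
open import Relation.Nullary using (¬_; Dec; yes; no; contradiction)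
open import Relation.Nullary.Decidable using (_⊎-dec_; from-yes)
open import Relation.Binary.Bundles using (Setoid)
open import Relation.Binary.PropositionalEquality
import Relation.Binary.Reasoning.Setoid as SetoidReasoning

AtMost : {N : ℕ} → ℕ → (Fin N → Set) → Set
AtMost {N} t P = Σ ((x : Fin N) → P x → Fin t) λ h →
  ∀ {x y} (p : P x) (q : P y) → h x p ≡ h y q → x ≡ y

AtMost-count : ∀ {N s t} {P : Fin N → Set} → AtMost t P →
  (f : Fin s → Fin N) → (∀ {i j} → f i ≡ f j → i ≡ j) → (∀ i → P (f i)) → s ≤ t
AtMost-count (h , h-inj) f f-inj inP = ≮⇒≥ λ t<s →
  let i , j , i<j , same = pigeonhole t<s (λ i → h (f i) (inP i))
  in <⇒≢ i<j (cong toℕ (f-inj (h-inj (inP i) (inP j) same)))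

AtMost-numbering : ∀ {N t} {P : Fin N → Set} (h : Fin N → ℕ) →
  (∀ x → P x → h x < t) → (∀ {x y} → P x → P y → h x ≡ h y → x ≡ y) → AtMost t P
AtMost-numbering h below h-inj = (λ x p → fromℕ< (below x p)) , λ {x} {y} p q same →
  h-inj p q (trans (sym (toℕ-fromℕ< (below x p))) (trans (cong toℕ same) (toℕ-fromℕ< (below y q))))

AtMost-mono : ∀ {N t} {P Q : Fin N → Set} → (∀ x → P x → Q x) → AtMost t Q → AtMost t P
AtMost-mono P⊆Q (h , h-inj) = (λ x p → h x (P⊆Q x p)) , λ p q → h-inj (P⊆Q _ p) (P⊆Q _ q)

AtMost-all : ∀ {N} {P : Fin N → Set} → AtMost N P
AtMost-all = (λ x _ → x) , λ _ _ same → same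

AtMost-none : ∀ {N} {P : Fin N → Set} → (∀ x → ¬ P x) → AtMost 0 P
AtMost-none empty = (λ x p → ⊥-elim (empty x p)) , λ p → ⊥-elim (empty _ p)

AtMost-split : ∀ {M e t₁ t₂} {P : Fin (M + e) → Set} →
  AtMost t₁ (λ y → P (y ↑ˡ e)) → AtMost t₂ (λ z → P (M ↑ʳ z)) → AtMost (t₁ + t₂) P
AtMost-split {M} {e} {t₁} {t₂} {P} (h₁ , h₁-inj) (h₂ , h₂-inj) = h , h-inj
  where
  hs : (s : Fin M ⊎ Fin e) → P (join M e s) → Fin (t₁ + t₂)
  hs (inj₁ y) p = h₁ y p ↑ˡ t₂
  hs (inj₂ z) p = t₁ ↑ʳ h₂ z p

  hs-inj : ∀ {s s'} (p : P (join M e s)) (q : P (join M e s')) → hs s p ≡ hs s' q → s ≡ s'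
  hs-inj {inj₁ y} {inj₁ y'} p q same = cong inj₁ (h₁-inj p q (↑ˡ-injective t₂ _ _ same))
  hs-inj {inj₂ z} {inj₂ z'} p q same = cong inj₂ (h₂-inj p q (↑ʳ-injective t₁ _ _ same))
  hs-inj {inj₁ y} {inj₂ z} p q same with () ←
    trans (sym (splitAt-↑ˡ t₁ _ t₂)) (trans (cong (splitAt t₁) same) (splitAt-↑ʳ t₁ t₂ _))
  hs-inj {inj₂ z} {inj₁ y} p q same with () ←
    trans (sym (splitAt-↑ʳ t₁ t₂ _)) (trans (cong (splitAt t₁) same) (splitAt-↑ˡ t₁ _ t₂))

  h : (x : Fin (M + e)) → P x → Fin (t₁ + t₂)
  h x p = hs (splitAt M x) (subst P (sym (join-splitAt M e x)) p)

  h-inj : ∀ {x y} (p : P x) (q : P y) → h x p ≡ h y q → x ≡ y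
  h-inj {x} {y} p q same = begin
    x                        ≡⟨ join-splitAt M e x ⟨
    join M e (splitAt M x)   ≡⟨ cong (join M e) (hs-inj {splitAt M x} {splitAt M y} _ _ same) ⟩
    join M e (splitAt M y)   ≡⟨ join-splitAt M e y ⟩
    y                        ∎
    where open ≡-Reasoning

AtMost-blowup : ∀ {L s a} {Q : Fin L → Set} →
  AtMost a Q → AtMost (a * s) (λ (x : Fin (L * s)) → Q (quotient {L} s x))
AtMost-blowup {L} {s} (H , H-inj) = (λ x q → combine (H (blk x) q) (copy x)) , h-inj
  where
  blk : Fin (L * s) → Fin L
  blk = quotient s
  copy : Fin (L * s) → Fin s
  copy = remainder {L} s

  h-inj : ∀ {x y} p q → combine (H (blk x) p) (copy x) ≡ combine (H (blk y) q) (copy y) → x ≡ y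
  h-inj {x} {y} p q same with combine-injective _ _ _ _ same
  ... | sameBlock , sameCopy = begin
    x                          ≡⟨ combine-remQuot {L} s x ⟨
    combine (blk x) (copy x)   ≡⟨ cong₂ combine (H-inj p q sameBlock) sameCopy ⟩
    combine (blk y) (copy y)   ≡⟨ combine-remQuot {L} s y ⟩
    y                          ∎
    where open ≡-Reasoning

-- Vertex set Fin (L * s + e): L blocks of s consecutive vertices; the e leftover vertices join block b₀.
block : ∀ {L} s e → Fin L → Fin (L * s + e) → Fin L
block {L} s e b₀ x = [ quotient {L} s , (λ _ → b₀) ]′ (splitAt (L * s) x)

block-bound : ∀ {L s e a} (b₀ : Fin L) {Q : Fin L → Set} {P : Fin (L * s + e) → Set} →
  AtMost a Q → (∀ x → P x → Q (block s e b₀ x)) → AtMost (a * s + e) P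
block-bound {L} {s} {e} b₀ {Q} {P} Q-small P-over-Q =
  AtMost-split (AtMost-mono over (AtMost-blowup Q-small)) AtMost-all
  where
  over : ∀ y → P (y ↑ˡ e) → Q (quotient {L} s y)
  over y p = subst Q (cong [ quotient {L} s , (λ _ → b₀) ]′ (splitAt-↑ˡ (L * s) y e)) (P-over-Q _ p)

RedNear : ∀ {N} → Colouring N → Fin N → Fin N → Fin N → Set
RedNear χ u v x = col χ u x ≡ red ⊎ col χ v x ≡ red

-- All k+m vertices of a red B_{k,m} are red-near its central edge; so small unions forbid it.
no-red-bistar : ∀ {N} (χ : Colouring N) k m {t} → 2 ≤ k → t < k + m → (∀ x → col χ x x ≡ red) →
  (∀ u v → col χ u v ≡ red → AtMost t (RedNear χ u v)) → ¬ ContainsCopy χ red (Bistar k m)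
no-red-bistar {N} χ (suc (suc k)) m (s≤s (s≤s _)) t<p diagonal small (f , f-inj , isRed) =
  <⇒≱ t<p (AtMost-count (small u v (isRed zero (suc zero) (inj₁ centre))) f f-inj near)
  where
  u v : Fin N
  u = f zero
  v = f (suc zero)
  -- vertices 2..k+1 are leaves of u, the remaining ones leaves of v
  near : ∀ i → RedNear χ u v (f i)
  near zero = inj₁ (diagonal u)
  near (suc zero) = inj₂ (diagonal v)
  near (suc (suc j)) with suc (suc (toℕ j)) ≤? suc (suc k)
  ... | yes j≤k = inj₁ (isRed zero (suc (suc j)) (inj₁ (leafV _ (s≤s (s≤s z≤n)) j≤k)))
  ... | no j≰k = inj₂ (isRed (suc zero) (suc (suc j)) (inj₁ (leafW _ (≰⇒> j≰k))))

-- The n leaves of a blue S_n lie in the blue neighbourhood of its centre.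
no-blue-star : ∀ {N} (χ : Colouring N) n {t} → t < n →
  (∀ c → AtMost t (λ x → col χ c x ≡ blue)) → ¬ ContainsCopy χ blue (Star n)
no-blue-star χ n t<n small (f , f-inj , isBlue) =
  <⇒≱ t<n (AtMost-count (small (f zero)) (f ∘ suc) (Fin-suc-injective ∘ f-inj)
                         (λ j → isBlue zero (suc j) (out (toℕ j))))

refuting-colouring : ∀ {N} k m n (χ : Colouring N) {t s} → 2 ≤ k → t < k + m → s < n →
  (∀ x → col χ x x ≡ red) → (∀ u v → col χ u v ≡ red → AtMost t (RedNear χ u v)) →
  (∀ c → AtMost s (λ x → col χ c x ≡ blue)) → ¬ Arrows N (Bistar k m) (Star n)
refuting-colouring k m n χ 2≤k t<p s<n diagonal red-small blue-small arrow =
  [ no-red-bistar χ k m 2≤k t<p diagonal red-small , no-blue-star χ n s<n blue-small ]′ (arrow χ)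

paint : {P : Set} → Dec P → Colour
paint (yes _) = red
paint (no _) = blue

paint-red : {P : Set} (d : Dec P) → paint d ≡ red → P
paint-red (yes p) _ = p

paint-blue : {P : Set} (d : Dec P) → paint d ≡ blue → ¬ P
paint-blue (no ¬p) _ = ¬p

paint-yes : {P : Set} (d : Dec P) → P → paint d ≡ red
paint-yes (yes _) _ = refl
paint-yes (no ¬p) p = contradiction p ¬p

paint-⇔ : {P Q : Set} → (P → Q) → (Q → P) → (d : Dec P) (d' : Dec Q) → paint d ≡ paint d'
paint-⇔ _ _ (yes _) (yes _) = refl
paint-⇔ _ _ (no _) (no _) = refl
paint-⇔ P⇒Q _ (yes p) (no ¬q) = contradiction (P⇒Q p) ¬q
paint-⇔ _ Q⇒P (no ¬p) (yes q) = contradiction (Q⇒P q) ¬p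

allRed : ∀ N → Colouring N
allRed N = record { col = λ _ _ → red ; sym = λ _ _ → refl }

module Cyclic (L : ℕ) .{{_ : NonZero L}} where

  infix 4 _≋_
  _≋_ : ℕ → ℕ → Set
  a ≋ b = a % L ≡ b % L

  ≋-setoid : Setoid 0ℓ 0ℓ
  ≋-setoid = record { Carrier = ℕ ; _≈_ = _≋_ ; isEquivalence = record { refl = refl ; sym = sym ; trans = trans } }

  module ≋-Reasoning = SetoidReasoning ≋-setoid

  +-congʳ-≋ : ∀ {a b} c → a ≋ b → a + c ≋ b + c
  +-congʳ-≋ {a} {b} c a≋b =
    trans (%-distribˡ-+ a c L) (trans (cong (λ z → (z + c % L) % L) a≋b) (sym (%-distribˡ-+ b c L)))

  +-congˡ-≋ : ∀ {a b} c → a ≋ b → c + a ≋ c + b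
  +-congˡ-≋ {a} {b} c a≋b = begin
    c + a ≡⟨ +-comm c a ⟩
    a + c ≈⟨ +-congʳ-≋ c a≋b ⟩
    b + c ≡⟨ +-comm b c ⟩
    c + b ∎
    where open ≋-Reasoning

  +L-≋ : ∀ a → a + L ≋ a
  +L-≋ a = [m+n]%n≡m%n a L

  %-≋ : ∀ a → a % L ≋ a
  %-≋ a = m%n%n≡m%n a L

  ≋-canonical : ∀ {a b} → a < L → b < L → a ≋ b → a ≡ b
  ≋-canonical {a} {b} a<L b<L a≋b = trans (sym (m<n⇒m%n≡m a<L)) (trans a≋b (m<n⇒m%n≡m b<L))

  -- adding L ∸ c % L undoes adding c
  +-cancelʳ-≋ : ∀ {a b} c → a + c ≋ b + c → a ≋ b
  +-cancelʳ-≋ {a} {b} c a+c≋b+c = begin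
    a                  ≈⟨ undo a ⟨
    a + c + c̄          ≈⟨ +-congʳ-≋ c̄ a+c≋b+c ⟩
    b + c + c̄          ≈⟨ undo b ⟩
    b                  ∎
    where
    open ≋-Reasoning
    c̄ : ℕ
    c̄ = L ∸ c % L
    undo : ∀ x → x + c + c̄ ≋ x
    undo x = begin
      x + c + c̄           ≈⟨ +-congʳ-≋ c̄ (+-congˡ-≋ x (%-≋ c)) ⟨
      x + c % L + c̄       ≡⟨ +-assoc x (c % L) c̄ ⟩
      x + (c % L + c̄)     ≡⟨ cong (x +_) (m+[n∸m]≡n (m%n≤n c L)) ⟩
      x + L               ≈⟨ +L-≋ x ⟩
      x                   ∎

  vertex-≋ : ∀ {x y : Fin L} → toℕ x ≋ toℕ y → x ≡ y
  vertex-≋ {x} {y} x≋y = toℕ-injective (≋-canonical (toℕ<n x) (toℕ<n y) x≋y)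

  -- 'off x y': the number of steps forward from y to x around the cycle.
  off : Fin L → Fin L → ℕ
  off x y = (toℕ x + (L ∸ toℕ y)) % L

  off<L : ∀ x y → off x y < L
  off<L x y = m%n<n _ L

  off-spec : ∀ x y → off x y + toℕ y ≋ toℕ x
  off-spec x y = begin
    off x y + toℕ y                       ≈⟨ +-congʳ-≋ (toℕ y) (%-≋ _) ⟩
    toℕ x + (L ∸ toℕ y) + toℕ y           ≡⟨ +-assoc (toℕ x) _ _ ⟩
    toℕ x + (L ∸ toℕ y + toℕ y)           ≡⟨ cong (toℕ x +_) (m∸n+n≡m (<⇒≤ (toℕ<n y))) ⟩
    toℕ x + L                             ≈⟨ +L-≋ (toℕ x) ⟩
    toℕ x                                 ∎
    where open ≋-Reasoning

  off-unique : ∀ {x y d} → d < L → d + toℕ y ≋ toℕ x → off x y ≡ d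
  off-unique {x} {y} d<L spec = ≋-canonical (off<L x y) d<L
    (+-cancelʳ-≋ (toℕ y) (trans (off-spec x y) (sym spec)))

  off-injective : ∀ x y c → off x c ≡ off y c → x ≡ y
  off-injective x y c same = vertex-≋ (begin
    toℕ x               ≈⟨ off-spec x c ⟨
    off x c + toℕ c     ≡⟨ cong (_+ toℕ c) same ⟩
    off y c + toℕ c     ≈⟨ off-spec y c ⟩
    toℕ y               ∎)
    where open ≋-Reasoning

  off-self : ∀ x → off x x ≡ 0
  off-self x = off-unique {x} {x} (>-nonZero⁻¹ L) refl

  off-complement : ∀ x y → 0 < off x y → off x y + off y x ≡ L
  off-complement x y positive = trans (cong (o +_) back) (m+[n∸m]≡n (<⇒≤ (off<L x y)))
    where
    open ≋-Reasoning
    o : ℕ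
    o = off x y
    back : off y x ≡ L ∸ o
    back = off-unique (∸-monoʳ-< positive (<⇒≤ (off<L x y))) (begin
      L ∸ o + toℕ x                 ≈⟨ +-congˡ-≋ (L ∸ o) (off-spec x y) ⟨
      L ∸ o + (o + toℕ y)           ≡⟨ +-assoc (L ∸ o) o (toℕ y) ⟨
      L ∸ o + o + toℕ y             ≡⟨ cong (_+ toℕ y) (m∸n+n≡m (<⇒≤ (off<L x y))) ⟩
      L + toℕ y                     ≡⟨ +-comm L (toℕ y) ⟩
      toℕ y + L                     ≈⟨ +L-≋ (toℕ y) ⟩
      toℕ y                         ∎)

  module Circulant (r : ℕ) where

    Near : Fin L → Fin L → Set
    Near a b = off b a ≤ r ⊎ off a b ≤ r

    near? : ∀ a b → Dec (Near a b)
    near? a b = (off b a ≤? r) ⊎-dec (off a b ≤? r)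

    near-refl : ∀ a → Near a a
    near-refl a = inj₁ (≤-trans (≤-reflexive (off-self a)) z≤n)

    near-sym : ∀ {a b} → Near a b → Near b a
    near-sym = swap

    -- 'pos u x': the position of x in the arc starting r steps before u.
    pos : Fin L → Fin L → ℕ
    pos u x = (off x u + r) % L

    pos-unique : ∀ {u x D} → D < L → D + toℕ u ≋ toℕ x + r → pos u x ≡ D
    pos-unique {u} {x} {D} D<L spec = ≋-canonical (m%n<n _ L) D<L (+-cancelʳ-≋ (toℕ u) (begin
      pos u x + toℕ u           ≈⟨ +-congʳ-≋ (toℕ u) (%-≋ _) ⟩
      off x u + r + toℕ u       ≡⟨ xy∙z≈xz∙y (off x u) r (toℕ u) ⟩
      off x u + toℕ u + r       ≈⟨ +-congʳ-≋ r (off-spec x u) ⟩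
      toℕ x + r                 ≈⟨ spec ⟨
      D + toℕ u                 ∎))
      where open ≋-Reasoning

    pos-injective : ∀ u x y → pos u x ≡ pos u y → x ≡ y
    pos-injective u x y same =
      off-injective x y u (≋-canonical (off<L x u) (off<L y u) (+-cancelʳ-≋ r same))

    -- If v is at most r steps after u, every vertex near u or v lies in the first 3r+1
    -- positions of the arc; each case names the position D of x and checks D + u ≋ x + r.
    pos-window : ∀ {u v x} → r + r + r < L → off v u ≤ r → Near u x ⊎ Near v x → pos u x ≤ r + r + r
    pos-window {u} {v} {x} 3r<L t≤r = placement
      where
      t : ℕ
      t = off v u
      2r≤3r : r + r ≤ r + r + r
      2r≤3r = m≤m+n (r + r) r

      placed : ∀ D → D ≤ r + r + r → D + toℕ u ≋ toℕ x + r → pos u x ≤ r + r + r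
      placed D D≤ spec = ≤-trans (≤-reflexive (pos-unique (≤-<-trans D≤ 3r<L) spec)) D≤

      placement : Near u x ⊎ Near v x → pos u x ≤ r + r + r
      -- x is a steps after u
      placement (inj₁ (inj₁ a≤r)) = placed (a + r) (≤-trans (+-monoˡ-≤ r a≤r) 2r≤3r) (begin
        a + r + toℕ u          ≡⟨ xy∙z≈xz∙y a r (toℕ u) ⟩
        a + toℕ u + r          ≈⟨ +-congʳ-≋ r (off-spec x u) ⟩
        toℕ x + r              ∎)
        where
        open ≋-Reasoning
        a : ℕ
        a = off x u
      -- x is a steps before u
      placement (inj₁ (inj₂ a≤r)) = placed (r ∸ a) (≤-trans (m∸n≤m r a) (≤-trans (m≤m+n r r) 2r≤3r)) (begin
        r ∸ a + toℕ u          ≈⟨ +-congˡ-≋ (r ∸ a) (off-spec u x) ⟨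
        r ∸ a + (a + toℕ x)    ≡⟨ +-assoc (r ∸ a) a (toℕ x) ⟨
        r ∸ a + a + toℕ x      ≡⟨ cong (_+ toℕ x) (m∸n+n≡m a≤r) ⟩
        r + toℕ x              ≡⟨ +-comm r (toℕ x) ⟩
        toℕ x + r              ∎)
        where
        open ≋-Reasoning
        a : ℕ
        a = off u x
      -- x is a steps after v, which is t steps after u
      placement (inj₂ (inj₁ a≤r)) = placed (a + t + r) (+-monoˡ-≤ r (+-mono-≤ a≤r t≤r)) (begin
        a + t + r + toℕ u      ≡⟨ xy∙z≈xz∙y (a + t) r (toℕ u) ⟩
        a + t + toℕ u + r      ≡⟨ cong (_+ r) (+-assoc a t (toℕ u)) ⟩
        a + (t + toℕ u) + r    ≈⟨ +-congʳ-≋ r (+-congˡ-≋ a (off-spec v u)) ⟩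
        a + toℕ v + r          ≈⟨ +-congʳ-≋ r (off-spec x v) ⟩
        toℕ x + r              ∎)
        where
        open ≋-Reasoning
        a : ℕ
        a = off x v
      -- x is a steps before v, which is t steps after u
      placement (inj₂ (inj₂ a≤r)) =
        placed D (≤-trans (m∸n≤m (t + r) a) (≤-trans (+-monoˡ-≤ r t≤r) 2r≤3r)) (+-cancelʳ-≋ a (begin
          D + toℕ u + a        ≡⟨ xy∙z≈xz∙y D (toℕ u) a ⟩
          D + a + toℕ u        ≡⟨ cong (_+ toℕ u) (m∸n+n≡m (≤-trans a≤r (m≤n+m r t))) ⟩
          t + r + toℕ u        ≡⟨ xy∙z≈xz∙y t r (toℕ u) ⟩
          t + toℕ u + r        ≈⟨ +-congʳ-≋ r (off-spec v u) ⟩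
          toℕ v + r            ≈⟨ +-congʳ-≋ r (off-spec v x) ⟨
          a + toℕ x + r        ≡⟨ xy∙z≈yz∙x a (toℕ x) r ⟩
          toℕ x + r + a        ∎))
        where
        open ≋-Reasoning
        a D : ℕ
        a = off v x
        D = t + r ∸ a

    ball-union-small : ∀ {u v} → r + r + r < L → Near u v →
      AtMost (suc (r + r + r)) (λ x → Near u x ⊎ Near v x)
    ball-union-small {u} {v} 3r<L (inj₁ v-after-u) =
      AtMost-numbering (pos u) (λ x near → s≤s (pos-window {u} {v} {x} 3r<L v-after-u near))
        (λ {x} {y} _ _ → pos-injective u x y)
    ball-union-small {u} {v} 3r<L (inj₂ u-after-v) =
      AtMost-numbering (pos v) (λ x near → s≤s (pos-window {v} {u} {x} 3r<L u-after-v (swap near)))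
        (λ {x} {y} _ _ → pos-injective v x y)

    -- A vertex far from c is more than r steps after c and more than r steps before it,
    -- so 'off x c ∸ (r+1)' numbers the far vertices below L - (2r+1).
    far-small : ∀ c → AtMost (L ∸ suc (r + r)) (λ x → ¬ Near c x)
    far-small c = AtMost-numbering gap gap-bound
      (λ {x} {y} far-x far-y same → off-injective x y c (∸-cancelʳ-≡ (after far-x) (after far-y) same))
      where
      gap : Fin L → ℕ
      gap x = off x c ∸ suc r
      after : ∀ {x} → ¬ Near c x → suc r ≤ off x c
      after far = ≰⇒> (far ∘ inj₁)
      gap-bound : ∀ x → ¬ Near c x → gap x < L ∸ suc (r + r)
      gap-bound x far = m+n≤o⇒m≤o∸n (suc (gap x)) (begin
        suc (gap x) + suc (r + r)      ≡⟨ regroup (gap x) ⟩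
        gap x + suc r + suc r          ≡⟨ cong (_+ suc r) (m∸n+n≡m (after far)) ⟩
        off x c + suc r                ≤⟨ +-monoʳ-≤ (off x c) (≰⇒> (far ∘ inj₂)) ⟩
        off x c + off c x              ≡⟨ off-complement x c (≤-trans (s≤s z≤n) (after far)) ⟩
        L                              ∎)
        where
        open ≤-Reasoning
        regroup : ∀ g → suc g + suc (r + r) ≡ g + suc r + suc r
        regroup g = solve (g ∷ r ∷ [])

    circulant : ∀ {N} → (Fin N → Fin L) → Colouring N
    circulant β = record
      { col = λ x y → paint (near? (β x) (β y))
      ; sym = λ x y → paint-⇔ (near-sym {β x} {β y}) (near-sym {β y} {β x})
                               (near? (β x) (β y)) (near? (β y) (β x)) }

    circulant-diagonal : ∀ {N} (β : Fin N → Fin L) x → col (circulant β) x x ≡ red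
    circulant-diagonal β x = paint-yes (near? (β x) (β x)) (near-refl (β x))

    circulant-red : ∀ {N} (β : Fin N → Fin L) {x y} → col (circulant β) x y ≡ red → Near (β x) (β y)
    circulant-red β {x} {y} = paint-red (near? (β x) (β y))

    circulant-blue : ∀ {N} (β : Fin N → Fin L) {x y} → col (circulant β) x y ≡ blue → ¬ Near (β x) (β y)
    circulant-blue β {x} {y} = paint-blue (near? (β x) (β y))

-- N < k + m: the all-red colouring has no blue edge and too few vertices for B_{k,m}.
all-red-refutes : ∀ k m n N → 2 ≤ k → 1 ≤ n → N < k + m → ¬ Arrows N (Bistar k m) (Star n)
all-red-refutes k m n N 2≤k 1≤n N<p = refuting-colouring k m n (allRed N) 2≤k N<p 1≤n
  (λ _ → refl) (λ _ _ _ → AtMost-all) (λ _ → AtMost-none (λ _ ()))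

-- Radius r admissible for p: 3r + 2 ≤ p and ⌊p/2⌋ ≤ 2r (stated as p < 2(2r + 1)).
Radius : ℕ → Set
Radius p = ∃[ r ] r + r + r + 2 ≤ p × p < suc (r + r) * 2

-- p ≥ 11 has an admissible radius: r = 3, 3, 3, 4 for p = 11..14, then p + 4 takes r + 1.
radius-from-11 : ∀ q → Radius (11 + q)
radius-from-11 0 = 3 , from-yes (11 ≤? 11) , from-yes (11 <? 14)
radius-from-11 1 = 3 , from-yes (11 ≤? 12) , from-yes (12 <? 14)
radius-from-11 2 = 3 , from-yes (11 ≤? 13) , from-yes (13 <? 14)
radius-from-11 3 = 4 , from-yes (14 ≤? 14) , from-yes (14 <? 18)
radius-from-11 (suc (suc (suc (suc q)))) with radius-from-11 q
... | r , fits , covers = suc r , fits′ , covers′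
  where
  open ≤-Reasoning
  fits′ : suc r + suc r + suc r + 2 ≤ 15 + q
  fits′ = begin
    suc r + suc r + suc r + 2    ≡⟨ solve (r ∷ []) ⟩
    3 + (r + r + r + 2)          ≤⟨ +-monoʳ-≤ 3 fits ⟩
    14 + q                       ≤⟨ n≤1+n _ ⟩
    15 + q                       ∎
  covers′ : 15 + q < suc (suc r + suc r) * 2
  covers′ = begin-strict
    4 + (11 + q)                 <⟨ +-monoʳ-< 4 covers ⟩
    4 + suc (r + r) * 2          ≡⟨ solve (r ∷ []) ⟩
    suc (suc r + suc r) * 2      ∎

-- Every p ≥ 8 other than 10 has an admissible radius (for p = 10,
-- 3r + 2 ≤ p forces r ≤ 2 while p < 2(2r + 1) needs r ≥ 3).
radius : ∀ p → 8 ≤ p → p ≢ 10 → Radius p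
radius p 8≤p p≢10 = subst Radius 8+[p∸8]≡p (from-8 (p ∸ 8) (λ eq → p≢10 (trans (sym 8+[p∸8]≡p) eq)))
  where
  8+[p∸8]≡p : 8 + (p ∸ 8) ≡ p
  8+[p∸8]≡p = m+[n∸m]≡n 8≤p
  from-8 : ∀ d → 8 + d ≢ 10 → Radius (8 + d)
  from-8 0 _ = 2 , from-yes (8 ≤? 8) , from-yes (8 <? 10)
  from-8 1 _ = 2 , from-yes (8 ≤? 9) , from-yes (9 <? 10)
  from-8 2 8+2≢10 = ⊥-elim (8+2≢10 refl)
  from-8 (suc (suc (suc q))) _ = radius-from-11 q

-- k + m ≤ N ≤ 2r + n: the circulant of radius r on Z_N.  A red edge sees an arc of
-- 3r + 1 < k + m vertices and a blue neighbourhood has N - (2r + 1) < n vertices.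
circulant-refutes : ∀ k m n N r → 2 ≤ k → 1 ≤ n → r + r + r + 2 ≤ k + m → k + m ≤ N → N ≤ r + r + n →
  ¬ Arrows N (Bistar k m) (Star n)
circulant-refutes k m n N r 2≤k 1≤n fits p≤N N≤2r+n =
  refuting-colouring k m n χ 2≤k red< blue< (circulant-diagonal id) red-small blue-small
  where
  red< : suc (r + r + r) < k + m
  red< = subst (_≤ k + m) (+-comm (r + r + r) 2) fits
  3r<N : r + r + r < N
  3r<N = ≤-trans (≤-trans (n≤1+n _) red<) p≤N
  instance
    N≢0 : NonZero N
    N≢0 = >-nonZero (≤-trans (s≤s z≤n) 3r<N)
    n≢0 : NonZero n
    n≢0 = >-nonZero 1≤n
  open Cyclic N
  open Circulant r
  χ : Colouring N
  χ = circulant id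
  blue< : N ∸ suc (r + r) < n
  blue< = m<n+o⇒m∸n<o N (suc (r + r)) (s≤s N≤2r+n)
  red-small : ∀ u v → col χ u v ≡ red → AtMost (suc (r + r + r)) (RedNear χ u v)
  red-small u v uv = AtMost-mono (λ x → ⊎-map (circulant-red id {u} {x}) (circulant-red id {v} {x}))
    (ball-union-small 3r<N (circulant-red id {u} {v} uv))
  blue-small : ∀ c → AtMost (N ∸ suc (r + r)) (λ x → col χ c x ≡ blue)
  blue-small c = AtMost-mono (λ x → circulant-blue id {c} {x}) (far-small c)

-- k + m = 10, N = 2L + e with e ≤ 1: the circulant of radius 1 on Z_L, each vertex blown
-- up into a pair (the leftover vertex joins block 0).  A red edge sees at most 4 blocks,
-- so 8 + e ≤ 9 vertices; a blue neighbourhood avoids 3 blocks, so has 2(L - 3) + e < n vertices.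
paired-refutes : ∀ k m n L e → 2 ≤ k → k + m ≡ 10 → 4 ≤ L → e ≤ 1 → L * 2 + e ≤ 5 + n →
  ¬ Arrows (L * 2 + e) (Bistar k m) (Star n)
paired-refutes k m n L@(suc _) e 2≤k p≡10 4≤L e≤1 size =
  refuting-colouring k m n χ 2≤k red< blue< (circulant-diagonal β) red-small blue-small
  where
  open Cyclic L
  open Circulant 1
  β : Fin (L * 2 + e) → Fin L
  β = block 2 e zero
  χ : Colouring (L * 2 + e)
  χ = circulant β
  red< : 8 + e < k + m
  red< = subst (8 + e <_) (sym p≡10) (s≤s (+-monoʳ-≤ 8 e≤1))
  blue< : (L ∸ 3) * 2 + e < n
  blue< = +-cancelʳ-≤ 5 _ n (begin
    suc ((L ∸ 3) * 2 + e) + 5    ≡⟨ regroup (L ∸ 3) ⟩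
    (L ∸ 3 + 3) * 2 + e          ≡⟨ cong (λ l → l * 2 + e) (m∸n+n≡m (≤-trans (n≤1+n 3) 4≤L)) ⟩
    L * 2 + e                    ≤⟨ size ⟩
    5 + n                        ≡⟨ +-comm 5 n ⟩
    n + 5                        ∎)
    where
    open ≤-Reasoning
    regroup : ∀ d → suc (d * 2 + e) + 5 ≡ (d + 3) * 2 + e
    regroup d = solve (d ∷ e ∷ [])
  red-small : ∀ u v → col χ u v ≡ red → AtMost (8 + e) (RedNear χ u v)
  red-small u v uv =
    block-bound {s = 2} {e = e} zero (ball-union-small {β u} {β v} 4≤L (circulant-red β {u} {v} uv))
    (λ x → ⊎-map (circulant-red β {u} {x}) (circulant-red β {v} {x}))
  blue-small : ∀ c → AtMost ((L ∸ 3) * 2 + e) (λ x → col χ c x ≡ blue)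
  blue-small c = block-bound {s = 2} {e = e} zero (far-small (β c)) (λ x → circulant-blue β {c} {x})

halves : ∀ N → N ≡ N / 2 * 2 + N % 2
halves N = trans (m≡m%n+[m/n]*n N 2) (+-comm (N % 2) (N / 2 * 2))

theorem3 : (k m n : ℕ) → 4 ≤ k → 4 ≤ m → 1 ≤ n →
    RamseyGreaterThan (Bistar k m) (Star n) (((k + m) / 2) + n)
theorem3 k m n 4≤k 4≤m 1≤n N N≤bound = refute (N <? k + m) (k + m ≟ 10)
  where
  2≤k : 2 ≤ k
  2≤k = ≤-trans (from-yes (2 ≤? 4)) 4≤k

  refute : Dec (N < k + m) → Dec (k + m ≡ 10) → ¬ Arrows N (Bistar k m) (Star n)
  refute (yes N<p) _ = all-red-refutes k m n N 2≤k 1≤n N<p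
  refute (no N≮p) (yes p≡10) = subst (λ M → ¬ Arrows M (Bistar k m) (Star n)) (sym (halves N))
    (paired-refutes k m n (N / 2) (N % 2) 2≤k p≡10 4≤N/2 (≤-pred (m%n<n N 2)) (subst (_≤ 5 + n) (halves N) N≤5+n))
    where
    4≤N/2 : 4 ≤ N / 2
    4≤N/2 = ≤-trans (n≤1+n 4) (/-monoˡ-≤ 2 (subst (_≤ N) p≡10 (≮⇒≥ N≮p)))
    N≤5+n : N ≤ 5 + n
    N≤5+n = subst (λ p → N ≤ p / 2 + n) p≡10 N≤bound
  refute (no N≮p) (no p≢10) with radius (k + m) (+-mono-≤ 4≤k 4≤m) p≢10
  ... | r , fits , covers = circulant-refutes k m n N r 2≤k 1≤n fits (≮⇒≥ N≮p)
    (≤-trans N≤bound (+-monoˡ-≤ n (≤-pred (m<n*o⇒m/o<n covers))))
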